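{- Let $G$ and $H$ be finite digraphs and $f:E(G)\to E(H)$ a mapping. Then either $FF(f,G,H)$ is finite or $FF(f,G,H)=\mathbb{N}$. In the latter case, $f$ is $\mathbb{Z}$-flow-continuous.
   Context: Digraphs are finite multidigraphs; loops and parallel edges are allowed. For an abelian group $M$, a map $\varphi:E(G)\to M$ is an $M$-flow if at every vertex $v$ the sum of $\varphi$ over edges leaving $v$ equals the sum of $\varphi$ over edges entering $v$. A mapping $f:E(G)\to E(H)$ is $M$-flow-continuous if for every $M$-flow $\varphi$ on $H$ the composition $\varphi\circ f$ is an $M$-flow on $G$. We set $FF(f,G,H)=\{n\ge 1: f \text{ is } \mathbb{Z}_n\text{ -flow-continuous}\}$ and $\mathbb{N}=\{1,2,3,\dots\}$. -}

module Defs where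

open import Data.Nat using (ℕ; suc; _≤_)
open import Data.Fin using (Fin)
open import Data.Fin.Properties using (_≟_)
open import Data.Integer using (ℤ; _-_; 0ℤ; +_; _+_)
open import Data.Integer.Divisibility using (_∣_)
open import Data.List using (List; foldr; map; filter)
open import Data.List using () renaming (allFin to allFinL)
open import Data.Product using (Σ; _×_)
open import Data.Sum using (_⊎_)
open import Relation.Binary.PropositionalEquality using (_≡_)

record Digraph : Set where
  field
    nV   : ℕ
    nE   : ℕ
    tail : Fin nE → Fin nV
    head : Fin nE → Fin nV
open Digraph public

Edge : Digraph → Set
Edge G = Fin (nE G)

Vertex : Digraph → Set
Vertex G = Fin (nV G)

sumℤ : List ℤ → ℤ
sumℤ = foldr _+_ 0ℤ

edges : (G : Digraph) → List (Edge G)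
edges G = allFinL (nE G)

outSum : (G : Digraph) → (Edge G → ℤ) → Vertex G → ℤ
outSum G φ v = sumℤ (map φ (filter (λ e → tail G e ≟ v) (edges G)))

inSum : (G : Digraph) → (Edge G → ℤ) → Vertex G → ℤ
inSum G φ v = sumℤ (map φ (filter (λ e → head G e ≟ v) (edges G)))

IsZFlow : (G : Digraph) → (Edge G → ℤ) → Set
IsZFlow G φ = (v : Vertex G) → outSum G φ v ≡ inSum G φ v

-- Z_n-flow: Z_n = Z / nZ is represented by integer representatives;
-- φ is a Z_n-flow iff the conservation law holds modulo n at every vertex.
IsZnFlow : ℕ → (G : Digraph) → (Edge G → ℤ) → Set
IsZnFlow n G φ = (v : Vertex G) → (+ n) ∣ (outSum G φ v - inSum G φ v)

ZnFlowContinuous : ℕ → (G H : Digraph) → (Edge G → Edge H) → Set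
ZnFlowContinuous n G H f = (φ : Edge H → ℤ) → IsZnFlow n H φ → IsZnFlow n G (λ e → φ (f e))

ZFlowContinuous : (G H : Digraph) → (Edge G → Edge H) → Set
ZFlowContinuous G H f = (φ : Edge H → ℤ) → IsZFlow H φ → IsZFlow G (λ e → φ (f e))

InFF : (G H : Digraph) → (Edge G → Edge H) → ℕ → Set
InFF G H f n = 1 ≤ n × ZnFlowContinuous n G H f

FFFinite : (G H : Digraph) → (Edge G → Edge H) → Set
FFFinite G H f = Σ ℕ λ B → (n : ℕ) → InFF G H f n → n ≤ B

FFAll : (G H : Digraph) → (Edge G → Edge H) → Set
FFAll G H f = (n : ℕ) → 1 ≤ n → ZnFlowContinuous n G H f

-- For a vertex v of G, the defect of ψ ∘ f at v is the pairing of ψ with the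
-- pushforward c_v of the v-th incidence row of G.  Every integer functional c
-- on the edges of H either is a coboundary p(tail e) − p(head e), and then
-- ⟪ c , ψ ⟫ = Σ_w p(w)·excess_ψ(w) is divisible by n for every ℤ_n-flow ψ and
-- vanishes for every ℤ-flow, or it is nonzero on some integer circulation ψ, and
-- then every n ∈ FF divides the nonzero integer ⟪ c_v , ψ ⟫.  The dichotomy is
-- proved by contracting the non-loop edges one at a time.
module Submission where

open import Data.Bool using (true; false; if_then_else_)
open import Data.Empty using (⊥-elim)
open import Data.Fin using (Fin; zero; suc)
open import Data.Fin.Properties using (_≟_; any?)
open import Data.Integer using (ℤ; 0ℤ; 1ℤ; -1ℤ; +_; _+_; _-_; _*_; ∣_∣)
open import Data.Integer.Divisibility using (_∣_)
import Data.Integer.Divisibility.Signed as Signed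
import Data.Integer.Properties as ℤ
open import Algebra.Properties.Semiring.Sum ℤ.+-*-semiring
  using (sum; ∑-distrib-+; ∑-comm; *-distribˡ-sum; *-distribʳ-sum; sum-cong-≗; sum-replicate-zero)
open import Data.Integer.Tactic.RingSolver using (solve-∀)
open import Data.List using (List; []; _∷_; map; filter; tabulate) renaming (allFin to allFinL)
open import Data.List.Membership.Propositional using (_∉_)
open import Data.List.Membership.Propositional.Properties using (∈-allFin)
open import Data.List.Relation.Unary.Any using (here; there)
open import Data.Nat as ℕ using (ℕ; zero; suc)
open import Data.Nat.Divisibility using (_∣0; ∣⇒≤)
open import Data.Product using (_×_; _,_; ∃; proj₁; proj₂)
open import Data.Sum as Sum using (_⊎_; inj₁; inj₂)
open import Function using (_∘_; id)
open import Relation.Binary.PropositionalEquality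
open import Relation.Nullary using (¬_; does; yes; no; ¬?)
open import Relation.Nullary.Decidable using (decidable-stable)

open import Defs

⟪_,_⟫ : ∀ {m} → (Fin m → ℤ) → (Fin m → ℤ) → ℤ
⟪ c , φ ⟫ = sum (λ i → c i * φ i)

δ : ∀ {m} → Fin m → Fin m → ℤ
δ x y = if does (x ≟ y) then 1ℤ else 0ℤ

δ-refl : ∀ {m} (x : Fin m) → δ x x ≡ 1ℤ
δ-refl x with x ≟ x
... | yes _   = refl
... | no x≢x = ⊥-elim (x≢x refl)

δ-≢ : ∀ {m} {x y : Fin m} → x ≢ y → δ x y ≡ 0ℤ
δ-≢ {x = x} {y} x≢y with x ≟ y
... | yes x≡y = ⊥-elim (x≢y x≡y)
... | no _    = refl

module _ {m : ℕ} where

  sum-zero : (w : Fin m → ℤ) → (∀ i → w i ≡ 0ℤ) → sum w ≡ 0ℤ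
  sum-zero w w≗0 = trans (sum-cong-≗ w≗0) (sum-replicate-zero m)

  pairing-comm : (c φ : Fin m → ℤ) → ⟪ c , φ ⟫ ≡ ⟪ φ , c ⟫
  pairing-comm c φ = sum-cong-≗ (λ i → ℤ.*-comm (c i) (φ i))

  pairing-congˡ : ∀ {c d} (φ : Fin m → ℤ) → (∀ i → c i ≡ d i) → ⟪ c , φ ⟫ ≡ ⟪ d , φ ⟫
  pairing-congˡ φ c≗d = sum-cong-≗ (λ i → cong (_* φ i) (c≗d i))

  pairing-congʳ : ∀ {φ ψ} (c : Fin m → ℤ) → (∀ i → φ i ≡ ψ i) → ⟪ c , φ ⟫ ≡ ⟪ c , ψ ⟫
  pairing-congʳ c φ≗ψ = sum-cong-≗ (λ i → cong (c i *_) (φ≗ψ i))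

  pairing-zeroʳ : (c φ : Fin m → ℤ) → (∀ i → φ i ≡ 0ℤ) → ⟪ c , φ ⟫ ≡ 0ℤ
  pairing-zeroʳ c φ φ≗0 = sum-zero _ (λ i → trans (cong (c i *_) (φ≗0 i)) (ℤ.*-zeroʳ (c i)))

  pairing-linearˡ : (c d φ : Fin m → ℤ) (k : ℤ) →
                    ⟪ (λ i → c i + k * d i) , φ ⟫ ≡ ⟪ c , φ ⟫ + k * ⟪ d , φ ⟫
  pairing-linearˡ c d φ k = begin
    sum (λ i → (c i + k * d i) * φ i)        ≡⟨ sum-cong-≗ (λ i → distrib (c i) k (d i) (φ i)) ⟩
    sum (λ i → c i * φ i + k * (d i * φ i))  ≡⟨ ∑-distrib-+ (λ i → c i * φ i) (λ i → k * (d i * φ i)) ⟩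
    ⟪ c , φ ⟫ + sum (λ i → k * (d i * φ i))  ≡⟨ cong (_+_ ⟪ c , φ ⟫) (*-distribˡ-sum k (λ i → d i * φ i)) ⟨
    ⟪ c , φ ⟫ + k * ⟪ d , φ ⟫                ∎
    where
    open ≡-Reasoning
    distrib : ∀ x k y z → (x + k * y) * z ≡ x * z + k * (y * z)
    distrib = solve-∀

  pairing-linearʳ : (c φ χ : Fin m → ℤ) (k : ℤ) →
                    ⟪ c , (λ i → φ i + k * χ i) ⟫ ≡ ⟪ c , φ ⟫ + k * ⟪ c , χ ⟫
  pairing-linearʳ c φ χ k = begin
    ⟪ c , (λ i → φ i + k * χ i) ⟫  ≡⟨ pairing-comm c _ ⟩
    ⟪ (λ i → φ i + k * χ i) , c ⟫  ≡⟨ pairing-linearˡ φ χ c k ⟩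
    ⟪ φ , c ⟫ + k * ⟪ χ , c ⟫      ≡⟨ cong₂ (λ x y → x + k * y) (pairing-comm φ c) (pairing-comm χ c) ⟩
    ⟪ c , φ ⟫ + k * ⟪ c , χ ⟫      ∎
    where open ≡-Reasoning

  pairing-subˡ : (c d φ : Fin m → ℤ) → ⟪ (λ i → c i - d i) , φ ⟫ ≡ ⟪ c , φ ⟫ - ⟪ d , φ ⟫
  pairing-subˡ c d φ = begin
    ⟪ (λ i → c i - d i) , φ ⟫         ≡⟨ pairing-congˡ φ (λ i → cong (_+_ (c i)) (ℤ.-1*i≡-i (d i))) ⟨
    ⟪ (λ i → c i + -1ℤ * d i) , φ ⟫   ≡⟨ pairing-linearˡ c d φ -1ℤ ⟩
    ⟪ c , φ ⟫ + -1ℤ * ⟪ d , φ ⟫       ≡⟨ cong (_+_ ⟪ c , φ ⟫) (ℤ.-1*i≡-i ⟪ d , φ ⟫) ⟩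
    ⟪ c , φ ⟫ - ⟪ d , φ ⟫             ∎
    where open ≡-Reasoning

pairing-δˡ : ∀ {m} (x : Fin m) (w : Fin m → ℤ) → ⟪ δ x , w ⟫ ≡ w x
pairing-δˡ {suc m} zero w = begin
  1ℤ * w zero + ⟪ (λ _ → 0ℤ) , w ∘ suc ⟫  ≡⟨ cong (_+_ (1ℤ * w zero)) (sum-zero _ (ℤ.*-zeroˡ ∘ w ∘ suc)) ⟩
  1ℤ * w zero + 0ℤ                        ≡⟨ ℤ.+-identityʳ _ ⟩
  1ℤ * w zero                             ≡⟨ ℤ.*-identityˡ _ ⟩
  w zero                                  ∎
  where open ≡-Reasoning
pairing-δˡ {suc m} (suc x) w = trans (ℤ.+-identityˡ _) (pairing-δˡ x (w ∘ suc))

pairing-δʳ : ∀ {m} (c : Fin m → ℤ) (x : Fin m) → ⟪ c , δ x ⟫ ≡ c x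
pairing-δʳ c x = trans (pairing-comm c (δ x)) (pairing-δˡ x c)

pairing-transpose : ∀ {k m} (M : Fin k → Fin m → ℤ) (p : Fin k → ℤ) (ψ : Fin m → ℤ) →
                    ⟪ (λ j → ⟪ (λ i → M i j) , p ⟫) , ψ ⟫ ≡ ⟪ p , (λ i → ⟪ M i , ψ ⟫) ⟫
pairing-transpose M p ψ = begin
  sum (λ j → sum (λ i → M i j * p i) * ψ j)    ≡⟨ sum-cong-≗ (λ j → *-distribʳ-sum (ψ j) (λ i → M i j * p i)) ⟩
  sum (λ j → sum (λ i → M i j * p i * ψ j))    ≡⟨ ∑-comm (λ j i → M i j * p i * ψ j) ⟩
  sum (λ i → sum (λ j → M i j * p i * ψ j))    ≡⟨ sum-cong-≗ (λ i → sum-cong-≗ (λ j → rearrange (M i j) (p i) (ψ j))) ⟩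
  sum (λ i → sum (λ j → p i * (M i j * ψ j)))  ≡⟨ sum-cong-≗ (λ i → *-distribˡ-sum (p i) (λ j → M i j * ψ j)) ⟨
  sum (λ i → p i * ⟪ M i , ψ ⟫)                ∎
  where
  open ≡-Reasoning
  rearrange : ∀ x y z → x * y * z ≡ y * (x * z)
  rearrange = solve-∀

sumℤ-map-tabulate : ∀ {A : Set} {m} (h : Fin m → A) (w : A → ℤ) →
                    sumℤ (map w (tabulate h)) ≡ sum (w ∘ h)
sumℤ-map-tabulate {m = zero}  h w = refl
sumℤ-map-tabulate {m = suc m} h w = cong (_+_ (w (h zero))) (sumℤ-map-tabulate (h ∘ suc) w)

sumℤ-map-filter : ∀ {A : Set} {n} (g : A → Fin n) (v : Fin n) (φ : A → ℤ) (xs : List A) →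
                  sumℤ (map φ (filter (λ x → g x ≟ v) xs)) ≡ sumℤ (map (λ x → δ (g x) v * φ x) xs)
sumℤ-map-filter g v φ []       = refl
sumℤ-map-filter g v φ (x ∷ xs) with does (g x ≟ v)
... | true  = cong₂ _+_ (sym (ℤ.*-identityˡ (φ x))) (sumℤ-map-filter g v φ xs)
... | false = trans (sumℤ-map-filter g v φ xs) (sym (ℤ.+-identityˡ _))

sumℤ-filter-allFin : ∀ {m n} (g : Fin m → Fin n) (v : Fin n) (φ : Fin m → ℤ) →
                     sumℤ (map φ (filter (λ x → g x ≟ v) (allFinL m))) ≡ ⟪ (λ x → δ (g x) v) , φ ⟫
sumℤ-filter-allFin {m} g v φ =
  trans (sumℤ-map-filter g v φ (allFinL m)) (sumℤ-map-tabulate id (λ x → δ (g x) v * φ x))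

incidence : (G : Digraph) → Vertex G → Edge G → ℤ
incidence G v e = δ (tail G e) v - δ (head G e) v

excess : (G : Digraph) → (Edge G → ℤ) → Vertex G → ℤ
excess G φ v = ⟪ incidence G v , φ ⟫

IsCirculation : (G : Digraph) → (Edge G → ℤ) → Set
IsCirculation G φ = ∀ v → excess G φ v ≡ 0ℤ

outSum-inSum≡excess : ∀ G φ v → outSum G φ v - inSum G φ v ≡ excess G φ v
outSum-inSum≡excess G φ v = trans
  (cong₂ _-_ (sumℤ-filter-allFin (tail G) v φ) (sumℤ-filter-allFin (head G) v φ))
  (sym (pairing-subˡ (λ e → δ (tail G e) v) (λ e → δ (head G e) v) φ))

module _ {G : Digraph} {φ : Edge G → ℤ} where

  isZnFlow⇒∣excess : ∀ {n} → IsZnFlow n G φ → ∀ v → + n ∣ excess G φ v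
  isZnFlow⇒∣excess {n} flow v = subst (_∣_ (+ n)) (outSum-inSum≡excess G φ v) (flow v)

  ∣excess⇒isZnFlow : ∀ {n} → (∀ v → + n ∣ excess G φ v) → IsZnFlow n G φ
  ∣excess⇒isZnFlow {n} n∣ v = subst (_∣_ (+ n)) (sym (outSum-inSum≡excess G φ v)) (n∣ v)

  isZFlow⇒isCirculation : IsZFlow G φ → IsCirculation G φ
  isZFlow⇒isCirculation flow v = trans (sym (outSum-inSum≡excess G φ v)) (ℤ.i≡j⇒i-j≡0 (flow v))

  isCirculation⇒isZFlow : IsCirculation G φ → IsZFlow G φ
  isCirculation⇒isZFlow circ v = ℤ.i-j≡0⇒i≡j _ _ (trans (outSum-inSum≡excess G φ v) (circ v))

  isCirculation⇒isZnFlow : ∀ {n} → IsCirculation G φ → IsZnFlow n G φ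
  isCirculation⇒isZnFlow {n} circ = ∣excess⇒isZnFlow (λ v → subst (_∣_ (+ n)) (sym (circ v)) (n ∣0))

coboundary : (H : Digraph) → (Vertex H → ℤ) → Edge H → ℤ
coboundary H p e = p (tail H e) - p (head H e)

IsCoboundary : (H : Digraph) → (Edge H → ℤ) → Set
IsCoboundary H c = ∃ λ p → ∀ e → c e ≡ coboundary H p e

NonzeroOnCirculation : (H : Digraph) → (Edge H → ℤ) → Set
NonzeroOnCirculation H c = ∃ λ ψ → IsCirculation H ψ × ⟪ c , ψ ⟫ ≢ 0ℤ

pairing-coboundary : ∀ H p ψ → ⟪ coboundary H p , ψ ⟫ ≡ ⟪ p , excess H ψ ⟫
pairing-coboundary H p ψ = trans (pairing-congˡ ψ coboundary≡) (pairing-transpose (incidence H) p ψ)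
  where
  coboundary≡ : ∀ e → coboundary H p e ≡ ⟪ (λ v → incidence H v e) , p ⟫
  coboundary≡ e = sym (trans (pairing-subˡ (δ (tail H e)) (δ (head H e)) p)
                             (cong₂ _-_ (pairing-δˡ (tail H e) p) (pairing-δˡ (head H e) p)))

∣-pairing : ∀ {m} {k} (p φ : Fin m → ℤ) → (∀ i → k ∣ φ i) → k ∣ ⟪ p , φ ⟫
∣-pairing {zero}  {k} p φ k∣φ = ∣ k ∣ ∣0
∣-pairing {suc m} {k} p φ k∣φ = Signed.∣⇒∣ᵤ {k} (Signed.∣m∣n⇒∣m+n {k}
  (Signed.∣n⇒∣m*n {k} (p zero) (Signed.∣ᵤ⇒∣ {k} (k∣φ zero)))
  (Signed.∣ᵤ⇒∣ {k} (∣-pairing {k = k} (p ∘ suc) (φ ∘ suc) (k∣φ ∘ suc))))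

module _ {H : Digraph} {c : Edge H → ℤ} (cob : IsCoboundary H c) {ψ : Edge H → ℤ} where

  coboundary-pairing-∣ : ∀ {k} → (∀ v → k ∣ excess H ψ v) → k ∣ ⟪ c , ψ ⟫
  coboundary-pairing-∣ {k} k∣excess = subst (_∣_ k) (sym pairing≡) (∣-pairing {k = k} p (excess H ψ) k∣excess)
    where
    p = proj₁ cob
    pairing≡ : ⟪ c , ψ ⟫ ≡ ⟪ p , excess H ψ ⟫
    pairing≡ = trans (pairing-congˡ ψ (proj₂ cob)) (pairing-coboundary H p ψ)

  coboundary-pairing-circulation : IsCirculation H ψ → ⟪ c , ψ ⟫ ≡ 0ℤ
  coboundary-pairing-circulation circ = trans (pairing-congˡ ψ (proj₂ cob))
    (trans (pairing-coboundary H (proj₁ cob) ψ) (pairing-zeroʳ (proj₁ cob) (excess H ψ) circ))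

IsLoop : (H : Digraph) → Edge H → Set
IsLoop H e = tail H e ≡ head H e

loop⇒isCirculation-δ : ∀ H e → IsLoop H e → IsCirculation H (δ e)
loop⇒isCirculation-δ H e loop v = trans (pairing-δʳ (incidence H v) e)
  (ℤ.i≡j⇒i-j≡0 (cong (λ x → δ x v) loop))

loops⇒coboundary-or-nonzero : ∀ H → (∀ e → IsLoop H e) → ∀ c →
                              IsCoboundary H c ⊎ NonzeroOnCirculation H c
loops⇒coboundary-or-nonzero H loops c with any? (λ e → ¬? (c e ℤ.≟ 0ℤ))
... | yes (e , ce≢0) = inj₂ (δ e , loop⇒isCirculation-δ H e (loops e) , ce≢0 ∘ trans (sym (pairing-δʳ c e)))
... | no ∄ce≢0       = inj₁ ((λ _ → 0ℤ) , λ e → decidable-stable (c e ℤ.≟ 0ℤ) (λ ce≢0 → ∄ce≢0 (e , ce≢0)))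

merge : ∀ {m} → Fin m → Fin m → Fin m → Fin m
merge a b x = if does (x ≟ b) then a else x

merge-source : ∀ {m} (a b : Fin m) → merge a b a ≡ a
merge-source a b with a ≟ b
... | yes _ = refl
... | no _  = refl

merge-target : ∀ {m} (a b : Fin m) → merge a b b ≡ a
merge-target a b with b ≟ b
... | yes _   = refl
... | no b≢b = ⊥-elim (b≢b refl)

δ-merge : ∀ {m} (a b x v : Fin m) → δ (merge a b x) v ≡ δ x v + δ x b * (δ a v - δ b v)
δ-merge a b x v with x ≟ b
... | yes refl = shift (δ a v) (δ b v)
  where
  shift : ∀ s t → s ≡ t + 1ℤ * (s - t)
  shift = solve-∀
... | no _     = sym (trans (cong (_+_ (δ x v)) (ℤ.*-zeroˡ (δ a v - δ b v))) (ℤ.+-identityʳ _))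

contract : (H : Digraph) → Vertex H → Vertex H → Digraph
contract H a b = record H { tail = merge a b ∘ tail H ; head = merge a b ∘ head H }

module _ (H : Digraph) (a b : Vertex H) where

  incidence-contract : ∀ v x → incidence (contract H a b) v x ≡
                               incidence H v x + (δ a v - δ b v) * incidence H b x
  incidence-contract v x rewrite δ-merge a b (tail H x) v | δ-merge a b (head H x) v =
    collect (δ (tail H x) v) (δ (head H x) v) (δ (tail H x) b) (δ (head H x) b) (δ a v - δ b v)
    where
    collect : ∀ t h t′ h′ d → (t + t′ * d) - (h + h′ * d) ≡ (t - h) + d * (t′ - h′)
    collect = solve-∀

  excess-contract : ∀ ψ v → excess (contract H a b) ψ v ≡ excess H ψ v + (δ a v - δ b v) * excess H ψ b
  excess-contract ψ v = trans (pairing-congˡ ψ (incidence-contract v))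
                              (pairing-linearˡ (incidence H v) (incidence H b) ψ (δ a v - δ b v))

  contract-isLoop : ∀ x → IsLoop H x → IsLoop (contract H a b) x
  contract-isLoop x = cong (merge a b)

module ContractEdge (H : Digraph) (e : Edge H) where

  private
    a = tail H e
    b = head H e

  contracted : Digraph
  contracted = contract H a b

  edge-isLoop : IsLoop contracted e
  edge-isLoop = trans (merge-source a b) (sym (merge-target a b))

  -- Adding c(e) times the cut at b changes c by a coboundary and makes it vanish on e.
  absorb : (Edge H → ℤ) → Edge H → ℤ
  absorb c x = c x + c e * incidence H b x

  absorb-edge : ∀ c → ¬ IsLoop H e → absorb c e ≡ 0ℤ
  absorb-edge c nonloop rewrite δ-≢ nonloop | δ-refl b = cancel (c e)
    where
    cancel : ∀ x → x + x * (0ℤ - 1ℤ) ≡ 0ℤ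
    cancel = solve-∀

  pairing-absorb : ∀ c φ → ⟪ absorb c , φ ⟫ ≡ ⟪ c , φ ⟫ + c e * excess H φ b
  pairing-absorb c φ = pairing-linearˡ c (incidence H b) φ (c e)

  lift-coboundary : ∀ c → IsCoboundary contracted (absorb c) → IsCoboundary H c
  lift-coboundary c (p′ , absorb≡) = p , c≡
    where
    p : Vertex H → ℤ
    p v = p′ (merge a b v) - c e * δ v b
    unshift : ∀ x k i → x ≡ (x + k * i) - k * i
    unshift = solve-∀
    regroup : ∀ P Q k t h → (P - Q) - k * (t - h) ≡ (P - k * t) - (Q - k * h)
    regroup = solve-∀
    c≡ : ∀ x → c x ≡ coboundary H p x
    c≡ x = begin
      c x                                                 ≡⟨ unshift (c x) (c e) (incidence H b x) ⟩
      absorb c x - c e * incidence H b x                  ≡⟨ cong (_- c e * incidence H b x) (absorb≡ x) ⟩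
      coboundary contracted p′ x - c e * incidence H b x  ≡⟨ regroup (p′ (merge a b (tail H x))) (p′ (merge a b (head H x)))
                                                                      (c e) (δ (tail H x) b) (δ (head H x) b) ⟩
      coboundary H p x                                    ∎
      where open ≡-Reasoning

  lift-nonzero : ∀ c → ¬ IsLoop H e → NonzeroOnCirculation contracted (absorb c) → NonzeroOnCirculation H c
  lift-nonzero c nonloop (ψ , circ , absorb≢0) = ψ̃ , circ̃ , absorb≢0 ∘ trans (sym pairing≡)
    where
    l = excess H ψ b
    -- ψ is conserved at the merged vertex only; sending the excess at b back along e repairs b.
    ψ̃ : Edge H → ℤ
    ψ̃ x = ψ x + l * δ e x
    excess≡ : ∀ v → excess H ψ̃ v ≡ excess contracted ψ v
    excess≡ v = begin
      excess H ψ̃ v                                ≡⟨ pairing-linearʳ (incidence H v) ψ (δ e) l ⟩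
      excess H ψ v + l * ⟪ incidence H v , δ e ⟫  ≡⟨ cong (λ y → excess H ψ v + l * y) (pairing-δʳ (incidence H v) e) ⟩
      excess H ψ v + l * (δ a v - δ b v)          ≡⟨ cong (_+_ (excess H ψ v)) (ℤ.*-comm l _) ⟩
      excess H ψ v + (δ a v - δ b v) * l          ≡⟨ excess-contract H a b ψ v ⟨
      excess contracted ψ v                       ∎
      where open ≡-Reasoning
    circ̃ : IsCirculation H ψ̃
    circ̃ v = trans (excess≡ v) (circ v)
    pairing≡ : ⟪ c , ψ̃ ⟫ ≡ ⟪ absorb c , ψ ⟫
    pairing≡ = begin
      ⟪ c , ψ̃ ⟫                                 ≡⟨ +-*-zero ⟪ c , ψ̃ ⟫ (c e) ⟨
      ⟪ c , ψ̃ ⟫ + c e * 0ℤ                      ≡⟨ cong (λ y → ⟪ c , ψ̃ ⟫ + c e * y) (circ̃ b) ⟨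
      ⟪ c , ψ̃ ⟫ + c e * excess H ψ̃ b            ≡⟨ pairing-absorb c ψ̃ ⟨
      ⟪ absorb c , ψ̃ ⟫                          ≡⟨ pairing-linearʳ (absorb c) ψ (δ e) l ⟩
      ⟪ absorb c , ψ ⟫ + l * ⟪ absorb c , δ e ⟫ ≡⟨ cong (λ y → ⟪ absorb c , ψ ⟫ + l * y) absorb-δ ⟩
      ⟪ absorb c , ψ ⟫ + l * 0ℤ                 ≡⟨ +-*-zero ⟪ absorb c , ψ ⟫ l ⟩
      ⟪ absorb c , ψ ⟫                          ∎
      where
      open ≡-Reasoning
      +-*-zero : ∀ x k → x + k * 0ℤ ≡ x
      +-*-zero = solve-∀
      absorb-δ : ⟪ absorb c , δ e ⟫ ≡ 0ℤ
      absorb-δ = trans (pairing-δʳ (absorb c) e) (absorb-edge c nonloop)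

outside-∷ : ∀ {m} {P Q : Fin m → Set} {e es} → (∀ x → x ∉ e ∷ es → P x) →
            (∀ x → P x → Q x) → Q e → ∀ x → x ∉ es → Q x
outside-∷ {e = e} P-outside P⇒Q Qe x x∉es with x ≟ e
... | yes refl = Qe
... | no x≢e   = P⇒Q x (P-outside x λ { (here x≡e) → x≢e x≡e ; (there x∈es) → x∉es x∈es })

coboundary-or-nonzero-loopsOutside : ∀ H (es : List (Edge H)) → (∀ e → e ∉ es → IsLoop H e) →
                                     ∀ c → IsCoboundary H c ⊎ NonzeroOnCirculation H c
coboundary-or-nonzero-loopsOutside H []       loops c = loops⇒coboundary-or-nonzero H (λ e → loops e λ ()) c
coboundary-or-nonzero-loopsOutside H (e ∷ es) loops c with tail H e ≟ head H e
... | yes loop   = coboundary-or-nonzero-loopsOutside H es (outside-∷ loops (λ _ → id) loop) c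
... | no nonloop = Sum.map (lift-coboundary c) (lift-nonzero c nonloop)
  (coboundary-or-nonzero-loopsOutside contracted es
    (outside-∷ loops (contract-isLoop H (tail H e) (head H e)) edge-isLoop) (absorb c))
  where open ContractEdge H e

coboundary-or-nonzero : ∀ H c → IsCoboundary H c ⊎ NonzeroOnCirculation H c
coboundary-or-nonzero H = coboundary-or-nonzero-loopsOutside H (allFinL (nE H)) (λ e e∉ → ⊥-elim (e∉ (∈-allFin e)))

pushforward : ∀ {m n} → (Fin m → Fin n) → (Fin m → ℤ) → Fin n → ℤ
pushforward f c y = ⟪ (λ x → δ (f x) y) , c ⟫

pairing-pushforward : ∀ {m n} (f : Fin m → Fin n) c ψ → ⟪ pushforward f c , ψ ⟫ ≡ ⟪ c , ψ ∘ f ⟫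
pairing-pushforward f c ψ = trans (pairing-transpose (δ ∘ f) c ψ) (pairing-congʳ c (λ x → pairing-δˡ (f x) ψ))

module _ (G H : Digraph) (f : Edge G → Edge H) where

  excess-∘ : ∀ ψ v → excess G (ψ ∘ f) v ≡ ⟪ pushforward f (incidence G v) , ψ ⟫
  excess-∘ ψ v = sym (pairing-pushforward f (incidence G v) ψ)

  module _ (cob : ∀ v → IsCoboundary H (pushforward f (incidence G v))) where

    coboundaries⇒ZnFlowContinuous : ∀ n → ZnFlowContinuous n G H f
    coboundaries⇒ZnFlowContinuous n ψ flow = ∣excess⇒isZnFlow {G} λ v →
      subst (_∣_ (+ n)) (sym (excess-∘ ψ v)) (coboundary-pairing-∣ (cob v) {k = + n} (isZnFlow⇒∣excess {H} flow))

    coboundaries⇒ZFlowContinuous : ZFlowContinuous G H f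
    coboundaries⇒ZFlowContinuous ψ flow = isCirculation⇒isZFlow {G} λ v →
      trans (excess-∘ ψ v) (coboundary-pairing-circulation (cob v) (isZFlow⇒isCirculation {H} flow))

  nonzero⇒FFFinite : ∀ v → NonzeroOnCirculation H (pushforward f (incidence G v)) → FFFinite G H f
  nonzero⇒FFFinite v (ψ , circ , D≢0) = ∣ D ∣ , n≤∣D∣
    where
    D = ⟪ pushforward f (incidence G v) , ψ ⟫
    n≤∣D∣ : ∀ n → InFF G H f n → n ℕ.≤ ∣ D ∣
    n≤∣D∣ n (_ , cont) = ∣⇒≤ {{ℕ.≢-nonZero (D≢0 ∘ ℤ.∣i∣≡0⇒i≡0)}}
      (subst (_∣_ (+ n)) (excess-∘ ψ v) (isZnFlow⇒∣excess {G} (cont ψ (isCirculation⇒isZnFlow {H} circ)) v))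

all-or-some : ∀ {m} {P Q : Fin m → Set} → (∀ i → P i ⊎ Q i) → (∀ i → P i) ⊎ ∃ Q
all-or-some {zero}  P⊎Q = inj₁ λ ()
all-or-some {suc m} P⊎Q with P⊎Q zero | all-or-some (P⊎Q ∘ suc)
... | inj₂ q | _            = inj₂ (zero , q)
... | inj₁ p | inj₁ ps      = inj₁ λ { zero → p ; (suc i) → ps i }
... | inj₁ _ | inj₂ (i , q) = inj₂ (suc i , q)

lemma2p5 : (G H : Digraph) → (f : Edge G → Edge H) →
    FFFinite G H f ⊎ (FFAll G H f × ZFlowContinuous G H f)
lemma2p5 G H f with all-or-some (λ v → coboundary-or-nonzero H (pushforward f (incidence G v)))
... | inj₁ cob       = inj₂ ( (λ n _ → coboundaries⇒ZnFlowContinuous G H f cob n)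
                            , coboundaries⇒ZFlowContinuous G H f cob )
... | inj₂ (v , nz)  = inj₁ (nonzero⇒FFFinite G H f v nz)
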